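{- Let $(g(x),f(x))$ be a Riordan array, let $n\ge2$, and let $(g(x),f(x))_n$ denote its $n\times n$ leading principal truncation. Let $S_n=(g(x),f(x))_n\cdot T_n$, where $T_n$ is the $n\times n$ upper-triangular matrix with all entries on and above the diagonal equal to $1$ (so $S_n$ has $(i,k)$-entry $\sum_{j\le k}[x^i]g f^j$), and let $H=S_n^{ -1}$, an $n\times n$ Hessenberg matrix with rows and columns indexed $1,\dots,n$. Let $P_{n-1}$ be the $(n-1)\times(n-1)$ submatrix of $H$ formed by rows $1,\dots,n-1$ and columns $2,\dots,n$. Then $$P_{n-1}=\left(\left(\frac{ -g(x)f(x)/x}{1-f(x)},f(x)\right)_{n-1}\right)^{ -1},$$ the inverse of the $(n-1)\times(n-1)$ leading truncation of the Riordan array $\left(\frac{ -g(x)f(x)/x}{1-f(x)},f(x)\right)$.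
   Context: Throughout, $g(x)=\sum_{i\ge0}g_ix^i$ and $f(x)=\sum_{i\ge1}f_ix^i$ are formal power series with integer coefficients, $g_0=1$, $f_1=1$. For a power series $u$ with $u(0)\ne0$ and $v$ with $v(0)=0$, $v'(0)\neq 0$, the Riordan array $(u(x),v(x))$ is the infinite lower-triangular matrix with $(i,k)$-entry $[x^i]u(x)v(x)^k$ ($i,k\ge0$), and $(u,v)_m$ denotes its $m\times m$ leading principal submatrix. -}

module Defs where

open import Data.Nat using (ℕ; zero; suc; _∸_; _≤?_)
open import Data.Product using (_×_)
open import Relation.Nullary using (yes; no)
open import Data.Fin using (Fin; toℕ; inject₁) renaming (zero to fzero; suc to fsuc)
open import Data.Integer using (ℤ; _+_; _*_; -_; 0ℤ; 1ℤ)
open import Relation.Binary.PropositionalEquality using (_≡_)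

Series : Set
Series = ℕ → ℤ

sumTo : ℕ → (ℕ → ℤ) → ℤ
sumTo zero    a = 0ℤ
sumTo (suc n) a = sumTo n a + a n

_⊛_ : Series → Series → Series
(a ⊛ b) i = sumTo (suc i) (λ j → a j * b (i ∸ j))

oneS : Series
oneS zero    = 1ℤ
oneS (suc _) = 0ℤ

_^S_ : Series → ℕ → Series
v ^S zero  = oneS
v ^S suc k = v ⊛ (v ^S k)

negS : Series → Series
negS a i = - a i

-- a(x)/x (for a with a(0) = 0): [x^i](a/x) = [x^{i+1}] a
divX : Series → Series
divX a i = a (suc i)

-- 1/(1 - v) = Σ_{k≥0} v^k for v(0) = 0; the coefficient of x^i only
-- receives contributions from k ≤ i.
geomS : Series → Series
geomS v i = sumTo (suc i) (λ k → (v ^S k) i)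

riordan : Series → Series → ℕ → ℕ → ℤ
riordan u v i k = (u ⊛ (v ^S k)) i

Mat : ℕ → Set
Mat m = Fin m → Fin m → ℤ

sumFin : ∀ {m} → (Fin m → ℤ) → ℤ
sumFin {zero}  a = 0ℤ
sumFin {suc m} a = a fzero + sumFin (λ j → a (fsuc j))

_·_ : ∀ {m} → Mat m → Mat m → Mat m
(A · B) i k = sumFin (λ j → A i j * B j k)

idMat : ∀ {m} → Mat m
idMat fzero    fzero    = 1ℤ
idMat fzero    (fsuc _) = 0ℤ
idMat (fsuc _) fzero    = 0ℤ
idMat (fsuc i) (fsuc k) = idMat i k

IsInverseOf : ∀ {m} → Mat m → Mat m → Set
IsInverseOf B A = (∀ i k → (B · A) i k ≡ idMat i k) × (∀ i k → (A · B) i k ≡ idMat i k)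

truncR : (m : ℕ) → Series → Series → Mat m
truncR m u v i k = riordan u v (toℕ i) (toℕ k)

upperOnes : (m : ℕ) → Mat m
upperOnes m i k with toℕ i ≤? toℕ k
... | yes _ = 1ℤ
... | no  _ = 0ℤ

Smat : (m : ℕ) → Series → Series → Mat m
Smat m g f = truncR m g f · upperOnes m

-- rows 1..m, columns 2..m+1 of an (m+1)×(m+1) matrix (1-based)
Psub : ∀ {m} → Mat (suc m) → Mat m
Psub H i k = H (inject₁ i) (fsuc k)

uSeries : Series → Series → Series
uSeries g f = negS (divX (g ⊛ f)) ⊛ geomS f

-- With R(i,j) = [x^i] g f^j and S(i,k) = Σ_{j≤k} R(i,j), the series u = -(g f/x)/(1 - f) satisfies
-- [x^k] u f^l = -Σ_{s≥0} [x^(k+1)] g f^(l+1+s) = S(k+1,l) - S(k+1,n-1) for k, l < n - 1,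
-- since R(k+1,j) = 0 for j > k+1.  So (u, f)_(n-1) is obtained from S_n by dropping the first
-- row and subtracting the last column from the others.  As the first row of S_n is all ones
-- (g(0) = 1, f(0) = 0), the identities H S = I and S H = I restricted to the relevant rows and
-- columns say exactly that P_(n-1) inverts this matrix.
module Submission where

open import Defs
open import Data.Nat using (ℕ; zero; suc; _∸_; _≤_; _<_; z≤n; s≤s; _≤?_)
import Data.Nat as ℕ
import Data.Nat.Properties as ℕ
open import Data.Fin using (Fin; toℕ; inject₁; fromℕ) renaming (zero to fzero; suc to fsuc)
import Data.Fin.Properties as Fin
open import Data.Integer using (ℤ; _+_; _*_; -_; _-_; 0ℤ; 1ℤ)
import Data.Integer.Properties as ℤ
open import Data.Integer.Tactic.RingSolver using (solve-∀)
open import Data.Empty using (⊥-elim)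
open import Data.Product using (_,_)
open import Relation.Nullary using (yes; no)
open import Relation.Binary.PropositionalEquality
open ≡-Reasoning

sumTo-cong : ∀ n {a b : ℕ → ℤ} → (∀ j → j < n → a j ≡ b j) → sumTo n a ≡ sumTo n b
sumTo-cong zero    a≡b = refl
sumTo-cong (suc n) a≡b = cong₂ _+_ (sumTo-cong n (λ j j<n → a≡b j (ℕ.m≤n⇒m≤1+n j<n))) (a≡b n ℕ.≤-refl)

sumTo-0 : ∀ n (a : ℕ → ℤ) → (∀ j → j < n → a j ≡ 0ℤ) → sumTo n a ≡ 0ℤ
sumTo-0 zero    a a≡0 = refl
sumTo-0 (suc n) a a≡0
  rewrite sumTo-0 n a (λ j j<n → a≡0 j (ℕ.m≤n⇒m≤1+n j<n)) | a≡0 n ℕ.≤-refl = refl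

sumTo-distrib-+ : ∀ n (a b : ℕ → ℤ) → sumTo n (λ j → a j + b j) ≡ sumTo n a + sumTo n b
sumTo-distrib-+ zero    a b = refl
sumTo-distrib-+ (suc n) a b rewrite sumTo-distrib-+ n a b = interchange (sumTo n a) (sumTo n b) (a n) (b n)
  where
  interchange : ∀ x y z w → (x + y) + (z + w) ≡ (x + z) + (y + w)
  interchange = solve-∀

sumTo-*ˡ : ∀ n c (a : ℕ → ℤ) → c * sumTo n a ≡ sumTo n (λ j → c * a j)
sumTo-*ˡ zero    c a = ℤ.*-zeroʳ c
sumTo-*ˡ (suc n) c a rewrite sym (sumTo-*ˡ n c a) = ℤ.*-distribˡ-+ c (sumTo n a) (a n)

sumTo-*ʳ : ∀ n c (a : ℕ → ℤ) → sumTo n a * c ≡ sumTo n (λ j → a j * c)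
sumTo-*ʳ n c a = begin
  sumTo n a * c            ≡⟨ ℤ.*-comm (sumTo n a) c ⟩
  c * sumTo n a            ≡⟨ sumTo-*ˡ n c a ⟩
  sumTo n (λ j → c * a j)  ≡⟨ sumTo-cong n (λ j _ → ℤ.*-comm c (a j)) ⟩
  sumTo n (λ j → a j * c)  ∎

sumTo-neg : ∀ n (a : ℕ → ℤ) → - sumTo n a ≡ sumTo n (λ j → - a j)
sumTo-neg zero    a = refl
sumTo-neg (suc n) a rewrite sym (sumTo-neg n a) = ℤ.neg-distrib-+ (sumTo n a) (a n)

sumTo-head : ∀ n (a : ℕ → ℤ) → sumTo (suc n) a ≡ a 0 + sumTo n (λ j → a (suc j))
sumTo-head zero    a = trans (ℤ.+-identityˡ (a 0)) (sym (ℤ.+-identityʳ (a 0)))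
sumTo-head (suc n) a rewrite sumTo-head n a = ℤ.+-assoc (a 0) _ _

sumTo-++ : ∀ n k (a : ℕ → ℤ) → sumTo (n ℕ.+ k) a ≡ sumTo n a + sumTo k (λ j → a (n ℕ.+ j))
sumTo-++ n zero    a rewrite ℕ.+-identityʳ n = sym (ℤ.+-identityʳ _)
sumTo-++ n (suc k) a rewrite ℕ.+-suc n k | sumTo-++ n k a = ℤ.+-assoc (sumTo n a) _ _

sumTo-truncate : ∀ K n (a : ℕ → ℤ) → (∀ j → K ≤ j → a j ≡ 0ℤ) → K ≤ n → sumTo n a ≡ sumTo K a
sumTo-truncate K n a a≡0 K≤n = begin
  sumTo n a                                        ≡⟨ cong (λ t → sumTo t a) (sym (ℕ.m+[n∸m]≡n K≤n)) ⟩
  sumTo (K ℕ.+ (n ∸ K)) a                          ≡⟨ sumTo-++ K (n ∸ K) a ⟩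
  sumTo K a + sumTo (n ∸ K) (λ j → a (K ℕ.+ j))    ≡⟨ cong (sumTo K a +_) (sumTo-0 (n ∸ K) _ (λ j _ → a≡0 (K ℕ.+ j) (ℕ.m≤m+n K j))) ⟩
  sumTo K a + 0ℤ                                   ≡⟨ ℤ.+-identityʳ _ ⟩
  sumTo K a                                        ∎

sumTo-reverse : ∀ n (a : ℕ → ℤ) → sumTo n a ≡ sumTo n (λ j → a (n ∸ suc j))
sumTo-reverse zero    a = refl
sumTo-reverse (suc n) a = begin
  sumTo n a + a n                          ≡⟨ cong (_+ a n) (sumTo-reverse n a) ⟩
  sumTo n (λ j → a (n ∸ suc j)) + a n      ≡⟨ ℤ.+-comm _ (a n) ⟩
  a n + sumTo n (λ j → a (n ∸ suc j))      ≡⟨ sym (sumTo-head n (λ j → a (n ∸ j))) ⟩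
  sumTo (suc n) (λ j → a (n ∸ j))          ∎

sumTo-swap : ∀ A B (F : ℕ → ℕ → ℤ) →
  sumTo A (λ j → sumTo B (F j)) ≡ sumTo B (λ s → sumTo A (λ j → F j s))
sumTo-swap zero    B F = sym (sumTo-0 B _ (λ _ _ → refl))
sumTo-swap (suc A) B F rewrite sumTo-swap A B F = sym (sumTo-distrib-+ B _ _)

sumTo-triangle : ∀ N (F : ℕ → ℕ → ℤ) →
  sumTo N (λ j → sumTo (suc j) (λ i → F i j)) ≡ sumTo N (λ i → sumTo (N ∸ i) (λ t → F i (i ℕ.+ t)))
sumTo-triangle zero    F = refl
sumTo-triangle (suc N) F = begin
  sumTo N (λ j → sumTo (suc j) (λ i → F i j)) + sumTo (suc N) (λ i → F i N)
    ≡⟨ cong₂ _+_ (sumTo-triangle N F) (sumTo-cong (suc N) (λ i i≤N → cong (F i) (sym (ℕ.m+[n∸m]≡n (ℕ.≤-pred i≤N))))) ⟩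
  sumTo N rows + sumTo (suc N) corner
    ≡⟨ cong (_+ sumTo (suc N) corner) (sym rows-drop-last) ⟩
  sumTo (suc N) rows + sumTo (suc N) corner
    ≡⟨ sym (sumTo-distrib-+ (suc N) rows corner) ⟩
  sumTo (suc N) (λ i → rows i + corner i)
    ≡⟨ sumTo-cong (suc N) (λ i i≤N → cong (λ z → sumTo z (λ t → F i (i ℕ.+ t))) (sym (ℕ.+-∸-assoc 1 (ℕ.≤-pred i≤N)))) ⟩
  sumTo (suc N) (λ i → sumTo (suc N ∸ i) (λ t → F i (i ℕ.+ t)))
    ∎
  where
  rows : ℕ → ℤ
  rows i = sumTo (N ∸ i) (λ t → F i (i ℕ.+ t))
  corner : ℕ → ℤ
  corner i = F i (i ℕ.+ (N ∸ i))
  rows-drop-last : sumTo (suc N) rows ≡ sumTo N rows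
  rows-drop-last rewrite ℕ.n∸n≡0 N = ℤ.+-identityʳ (sumTo N rows)

⊛-cong : ∀ {a a' b b' : Series} → (∀ j → a j ≡ a' j) → (∀ j → b j ≡ b' j) → ∀ i → (a ⊛ b) i ≡ (a' ⊛ b') i
⊛-cong a≡a' b≡b' i = sumTo-cong (suc i) (λ j _ → cong₂ _*_ (a≡a' j) (b≡b' (i ∸ j)))

⊛-congʳ : ∀ (a : Series) {b b' : Series} → (∀ j → b j ≡ b' j) → ∀ i → (a ⊛ b) i ≡ (a ⊛ b') i
⊛-congʳ a = ⊛-cong {a} (λ _ → refl)

⊛-comm : ∀ (a b : Series) i → (a ⊛ b) i ≡ (b ⊛ a) i
⊛-comm a b i = trans (sumTo-reverse (suc i) (λ j → a j * b (i ∸ j)))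
  (sumTo-cong (suc i) (λ j j≤i → trans (cong (λ z → a (i ∸ j) * b z) (ℕ.m∸[m∸n]≡n (ℕ.≤-pred j≤i)))
                                        (ℤ.*-comm (a (i ∸ j)) (b j))))

⊛-assoc : ∀ (a b c : Series) n → ((a ⊛ b) ⊛ c) n ≡ (a ⊛ (b ⊛ c)) n
⊛-assoc a b c n = begin
  sumTo (suc n) (λ j → sumTo (suc j) (λ i → a i * b (j ∸ i)) * c (n ∸ j))
    ≡⟨ sumTo-cong (suc n) (λ j _ → sumTo-*ʳ (suc j) (c (n ∸ j)) (λ i → a i * b (j ∸ i))) ⟩
  sumTo (suc n) (λ j → sumTo (suc j) (λ i → a i * b (j ∸ i) * c (n ∸ j)))
    ≡⟨ sumTo-triangle (suc n) (λ i j → a i * b (j ∸ i) * c (n ∸ j)) ⟩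
  sumTo (suc n) (λ i → sumTo (suc n ∸ i) (λ t → a i * b (i ℕ.+ t ∸ i) * c (n ∸ (i ℕ.+ t))))
    ≡⟨ sumTo-cong (suc n) (λ i i≤n → row i (ℕ.≤-pred i≤n)) ⟩
  sumTo (suc n) (λ i → a i * sumTo (suc (n ∸ i)) (λ t → b t * c (n ∸ i ∸ t)))
    ∎
  where
  row : ∀ i → i ≤ n → sumTo (suc n ∸ i) (λ t → a i * b (i ℕ.+ t ∸ i) * c (n ∸ (i ℕ.+ t)))
                      ≡ a i * sumTo (suc (n ∸ i)) (λ t → b t * c (n ∸ i ∸ t))
  row i i≤n = begin
    sumTo (suc n ∸ i) (λ t → a i * b (i ℕ.+ t ∸ i) * c (n ∸ (i ℕ.+ t)))
      ≡⟨ cong (λ z → sumTo z (λ t → a i * b (i ℕ.+ t ∸ i) * c (n ∸ (i ℕ.+ t)))) (ℕ.+-∸-assoc 1 i≤n) ⟩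
    sumTo (suc (n ∸ i)) (λ t → a i * b (i ℕ.+ t ∸ i) * c (n ∸ (i ℕ.+ t)))
      ≡⟨ sumTo-cong (suc (n ∸ i)) (λ t _ → trans (cong₂ (λ x y → a i * b x * c y) (ℕ.m+n∸m≡n i t) (sym (ℕ.∸-+-assoc n i t)))
                                                  (ℤ.*-assoc (a i) (b t) _)) ⟩
    sumTo (suc (n ∸ i)) (λ t → a i * (b t * c (n ∸ i ∸ t)))
      ≡⟨ sym (sumTo-*ˡ (suc (n ∸ i)) (a i) _) ⟩
    a i * sumTo (suc (n ∸ i)) (λ t → b t * c (n ∸ i ∸ t))
      ∎

oneS-⊛ : ∀ (b : Series) i → (oneS ⊛ b) i ≡ b i
oneS-⊛ b i = begin
  sumTo (suc i) (λ j → oneS j * b (i ∸ j))         ≡⟨ sumTo-head i _ ⟩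
  1ℤ * b i + sumTo i (λ j → 0ℤ * b (i ∸ suc j))    ≡⟨ cong₂ _+_ (ℤ.*-identityˡ (b i)) (sumTo-0 i _ (λ _ _ → refl)) ⟩
  b i + 0ℤ                                         ≡⟨ ℤ.+-identityʳ (b i) ⟩
  b i                                              ∎

negS-⊛ : ∀ (a b : Series) i → (negS a ⊛ b) i ≡ - (a ⊛ b) i
negS-⊛ a b i = trans (sumTo-cong (suc i) (λ j _ → sym (ℤ.neg-distribˡ-* (a j) (b (i ∸ j)))))
                     (sym (sumTo-neg (suc i) _))

divX-⊛ : ∀ (a b : Series) → a 0 ≡ 0ℤ → ∀ k → (divX a ⊛ b) k ≡ (a ⊛ b) (suc k)
divX-⊛ a b a₀≡0 k = sym (begin
  sumTo (suc (suc k)) (λ j → a j * b (suc k ∸ j))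
    ≡⟨ sumTo-head (suc k) _ ⟩
  a 0 * b (suc k) + (divX a ⊛ b) k
    ≡⟨ cong (λ z → z * b (suc k) + (divX a ⊛ b) k) a₀≡0 ⟩
  0ℤ * b (suc k) + (divX a ⊛ b) k
    ≡⟨ ℤ.+-identityˡ _ ⟩
  (divX a ⊛ b) k
    ∎)

⊛-order-0 : ∀ (a b : Series) → b 0 ≡ 0ℤ → (a ⊛ b) 0 ≡ 0ℤ
⊛-order-0 a b b₀≡0 rewrite b₀≡0 = trans (ℤ.+-identityˡ (a 0 * 0ℤ)) (ℤ.*-zeroʳ (a 0))

-- Σ_s F_s is locally finite since F_s has order at least s.
⊛-sum : ∀ (a : Series) (F : ℕ → Series) → (∀ s i → i < s → F s i ≡ 0ℤ) → ∀ N →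
  (a ⊛ (λ i → sumTo (suc i) (λ s → F s i))) N ≡ sumTo (suc N) (λ s → (a ⊛ F s) N)
⊛-sum a F order N = begin
  sumTo (suc N) (λ j → a j * sumTo (suc (N ∸ j)) (λ s → F s (N ∸ j)))
    ≡⟨ sumTo-cong (suc N) (λ j _ → cong (a j *_) (sym (sumTo-truncate (suc (N ∸ j)) (suc N) _
                                                          (λ s → order s (N ∸ j)) (s≤s (ℕ.m∸n≤m N j))))) ⟩
  sumTo (suc N) (λ j → a j * sumTo (suc N) (λ s → F s (N ∸ j)))
    ≡⟨ sumTo-cong (suc N) (λ j _ → sumTo-*ˡ (suc N) (a j) _) ⟩
  sumTo (suc N) (λ j → sumTo (suc N) (λ s → a j * F s (N ∸ j)))
    ≡⟨ sumTo-swap (suc N) (suc N) _ ⟩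
  sumTo (suc N) (λ s → (a ⊛ F s) N)
    ∎

^S-order : ∀ (f : Series) → f 0 ≡ 0ℤ → ∀ t i → i < t → (f ^S t) i ≡ 0ℤ
^S-order f f₀≡0 (suc t) i i<t = sumTo-0 (suc i) _ term≡0
  where
  term≡0 : ∀ j → j < suc i → f j * (f ^S t) (i ∸ j) ≡ 0ℤ
  term≡0 zero    _ rewrite f₀≡0 = refl
  term≡0 (suc j) (s≤s j<i) = trans (cong (f (suc j) *_) (^S-order f f₀≡0 t (i ∸ suc j) i-j<t))
                                   (ℤ.*-zeroʳ (f (suc j)))
    where
    i-j<t : i ∸ suc j < t
    i-j<t = ℕ.<-≤-trans (ℕ.∸-monoʳ-< {i} {suc j} {0} (s≤s z≤n) j<i) (ℕ.≤-pred i<t)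

^S-+ : ∀ (f : Series) p s i → ((f ^S p) ⊛ (f ^S s)) i ≡ (f ^S (p ℕ.+ s)) i
^S-+ f zero    s i = oneS-⊛ (f ^S s) i
^S-+ f (suc p) s i = trans (⊛-assoc f (f ^S p) (f ^S s) i) (⊛-congʳ f (^S-+ f p s) i)

^S-⊛-geomS : ∀ (f : Series) → f 0 ≡ 0ℤ → ∀ p i →
  ((f ^S p) ⊛ geomS f) i ≡ sumTo (suc i) (λ s → (f ^S (p ℕ.+ s)) i)
^S-⊛-geomS f f₀≡0 p i = begin
  ((f ^S p) ⊛ geomS f) i                              ≡⟨ ⊛-sum (f ^S p) (f ^S_) (^S-order f f₀≡0) i ⟩
  sumTo (suc i) (λ s → ((f ^S p) ⊛ (f ^S s)) i)      ≡⟨ sumTo-cong (suc i) (λ s _ → ^S-+ f p s i) ⟩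
  sumTo (suc i) (λ s → (f ^S (p ℕ.+ s)) i)           ∎

riordan-above-diagonal : ∀ (g f : Series) → f 0 ≡ 0ℤ → ∀ i k → i < k → riordan g f i k ≡ 0ℤ
riordan-above-diagonal g f f₀≡0 i k i<k = sumTo-0 (suc i) _ (λ j _ →
  trans (cong (g j *_) (^S-order f f₀≡0 k (i ∸ j) (ℕ.≤-<-trans (ℕ.m∸n≤m i j) i<k))) (ℤ.*-zeroʳ (g j)))

-- [x^k] u f^l = -[x^(k+1)] Σ_s g f^(l+1+s), as u f^l = -(1/x) g f^(l+1)/(1 - f).
riordan-uSeries : ∀ (g f : Series) → f 0 ≡ 0ℤ → ∀ k l →
  riordan (uSeries g f) f k l ≡ - sumTo (suc (suc k)) (λ s → riordan g f (suc k) (suc l ℕ.+ s))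
riordan-uSeries g f f₀≡0 k l = begin
  ((negS (divX (g ⊛ f)) ⊛ geomS f) ⊛ (f ^S l)) k
    ≡⟨ ⊛-assoc (negS (divX (g ⊛ f))) (geomS f) (f ^S l) k ⟩
  (negS (divX (g ⊛ f)) ⊛ (geomS f ⊛ (f ^S l))) k
    ≡⟨ negS-⊛ (divX (g ⊛ f)) (geomS f ⊛ (f ^S l)) k ⟩
  - (divX (g ⊛ f) ⊛ (geomS f ⊛ (f ^S l))) k
    ≡⟨ cong -_ (divX-⊛ (g ⊛ f) (geomS f ⊛ (f ^S l)) (⊛-order-0 g f f₀≡0) k) ⟩
  - ((g ⊛ f) ⊛ (geomS f ⊛ (f ^S l))) (suc k)
    ≡⟨ cong -_ (⊛-assoc g f (geomS f ⊛ (f ^S l)) (suc k)) ⟩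
  - (g ⊛ (f ⊛ (geomS f ⊛ (f ^S l)))) (suc k)
    ≡⟨ cong -_ (⊛-congʳ g geometric-tail (suc k)) ⟩
  - (g ⊛ (λ i → sumTo (suc i) (λ s → (f ^S (suc l ℕ.+ s)) i))) (suc k)
    ≡⟨ cong -_ (⊛-sum g (λ s → f ^S (suc l ℕ.+ s)) tail-order (suc k)) ⟩
  - sumTo (suc (suc k)) (λ s → riordan g f (suc k) (suc l ℕ.+ s))
    ∎
  where
  tail-order : ∀ s i → i < s → (f ^S (suc l ℕ.+ s)) i ≡ 0ℤ
  tail-order s i i<s = ^S-order f f₀≡0 (suc l ℕ.+ s) i (ℕ.<-≤-trans i<s (ℕ.m≤n+m s (suc l)))
  geometric-tail : ∀ i → (f ⊛ (geomS f ⊛ (f ^S l))) i ≡ sumTo (suc i) (λ s → (f ^S (suc l ℕ.+ s)) i)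
  geometric-tail i = begin
    (f ⊛ (geomS f ⊛ (f ^S l))) i   ≡⟨ sym (⊛-assoc f (geomS f) (f ^S l) i) ⟩
    ((f ⊛ geomS f) ⊛ (f ^S l)) i   ≡⟨ ⊛-cong {f ⊛ geomS f} {geomS f ⊛ f} {f ^S l} (⊛-comm f (geomS f)) (λ _ → refl) i ⟩
    ((geomS f ⊛ f) ⊛ (f ^S l)) i   ≡⟨ ⊛-assoc (geomS f) f (f ^S l) i ⟩
    (geomS f ⊛ (f ^S suc l)) i     ≡⟨ ⊛-comm (geomS f) (f ^S suc l) i ⟩
    ((f ^S suc l) ⊛ geomS f) i     ≡⟨ ^S-⊛-geomS f f₀≡0 (suc l) i ⟩
    sumTo (suc i) (λ s → (f ^S (suc l ℕ.+ s)) i) ∎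

-- Row k + 1 of (g, f) vanishes beyond column k + 1 ≤ m, so the tail can be cut at column m.
riordan-uSeries-partial-sums : ∀ (g f : Series) → f 0 ≡ 0ℤ → ∀ m k l → k < m → l < m →
  riordan (uSeries g f) f k l ≡ sumTo (suc l) (riordan g f (suc k)) - sumTo (suc m) (riordan g f (suc k))
riordan-uSeries-partial-sums g f f₀≡0 m k l k<m l<m = begin
  riordan (uSeries g f) f k l                ≡⟨ riordan-uSeries g f f₀≡0 k l ⟩
  - sumTo (suc (suc k)) tail                 ≡⟨ cong -_ (sumTo-truncate K (suc (suc k)) tail tail-vanishes K≤k+2) ⟩
  - sumTo K tail                             ≡⟨ cong -_ (sym (sumTo-truncate K (m ∸ l) tail tail-vanishes K≤m-l)) ⟩
  - sumTo (m ∸ l) tail                       ≡⟨ neg-as-difference (sumTo (suc l) row) (sumTo (m ∸ l) tail) ⟩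
  sumTo (suc l) row - (sumTo (suc l) row + sumTo (m ∸ l) tail)
    ≡⟨ cong (λ z → sumTo (suc l) row - z) (sym (sumTo-++ (suc l) (m ∸ l) row)) ⟩
  sumTo (suc l) row - sumTo (suc l ℕ.+ (m ∸ l)) row
    ≡⟨ cong (λ z → sumTo (suc l) row - sumTo (suc z) row) (ℕ.m+[n∸m]≡n (ℕ.<⇒≤ l<m)) ⟩
  sumTo (suc l) row - sumTo (suc m) row
    ∎
  where
  row tail : ℕ → ℤ
  row = riordan g f (suc k)
  tail s = row (suc l ℕ.+ s)
  K : ℕ
  K = suc k ∸ l
  tail-vanishes : ∀ s → K ≤ s → tail s ≡ 0ℤ
  tail-vanishes s K≤s = riordan-above-diagonal g f f₀≡0 (suc k) (suc l ℕ.+ s)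
    (s≤s (ℕ.≤-trans (ℕ.m≤n+m∸n (suc k) l) (ℕ.+-monoʳ-≤ l K≤s)))
  K≤k+2 : K ≤ suc (suc k)
  K≤k+2 = ℕ.≤-trans (ℕ.m∸n≤m (suc k) l) (ℕ.n≤1+n (suc k))
  K≤m-l : K ≤ m ∸ l
  K≤m-l = ℕ.∸-monoˡ-≤ l k<m
  neg-as-difference : ∀ x y → - y ≡ x - (x + y)
  neg-as-difference = solve-∀

sumFin-cong : ∀ {n} {a b : Fin n → ℤ} → (∀ j → a j ≡ b j) → sumFin a ≡ sumFin b
sumFin-cong {zero}  a≡b = refl
sumFin-cong {suc n} a≡b = cong₂ _+_ (a≡b fzero) (sumFin-cong (λ j → a≡b (fsuc j)))

sumFin≡sumTo : ∀ n (F : ℕ → ℤ) → sumFin {n} (λ j → F (toℕ j)) ≡ sumTo n F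
sumFin≡sumTo zero    F = refl
sumFin≡sumTo (suc n) F = trans (cong (F 0 +_) (sumFin≡sumTo n (λ t → F (suc t)))) (sym (sumTo-head n F))

sumFin-distrib-- : ∀ {n} (a b : Fin n → ℤ) → sumFin (λ j → a j - b j) ≡ sumFin a - sumFin b
sumFin-distrib-- {zero}  a b = refl
sumFin-distrib-- {suc n} a b rewrite sumFin-distrib-- (λ j → a (fsuc j)) (λ j → b (fsuc j)) =
  interchange (a fzero) (b fzero) _ _
  where
  interchange : ∀ x y z w → (x - y) + (z - w) ≡ (x + z) - (y + w)
  interchange = solve-∀

sumFin-*ˡ : ∀ {n} c (a : Fin n → ℤ) → sumFin (λ j → c * a j) ≡ c * sumFin a
sumFin-*ˡ {zero}  c a = sym (ℤ.*-zeroʳ c)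
sumFin-*ˡ {suc n} c a rewrite sumFin-*ˡ c (λ j → a (fsuc j)) = sym (ℤ.*-distribˡ-+ c _ _)

sumFin-last : ∀ {m} (a : Fin (suc m) → ℤ) → sumFin a ≡ sumFin (λ j → a (inject₁ j)) + a (fromℕ m)
sumFin-last {zero}  a = trans (ℤ.+-identityʳ (a fzero)) (sym (ℤ.+-identityˡ (a fzero)))
sumFin-last {suc m} a rewrite sumFin-last {m} (λ j → a (fsuc j)) = sym (ℤ.+-assoc (a fzero) _ _)

idMat-inject₁ : ∀ {m} (i l : Fin m) → idMat (inject₁ i) (inject₁ l) ≡ idMat i l
idMat-inject₁ fzero    fzero    = refl
idMat-inject₁ fzero    (fsuc l) = refl
idMat-inject₁ (fsuc i) fzero    = refl
idMat-inject₁ (fsuc i) (fsuc l) = idMat-inject₁ i l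

idMat-inject₁-fromℕ : ∀ {m} (i : Fin m) → idMat (inject₁ i) (fromℕ m) ≡ 0ℤ
idMat-inject₁-fromℕ fzero    = refl
idMat-inject₁-fromℕ (fsuc i) = idMat-inject₁-fromℕ i

≤-indicator : ℕ → ℕ → ℤ
≤-indicator a b with a ≤? b
... | yes _ = 1ℤ
... | no  _ = 0ℤ

upperOnes≡≤-indicator : ∀ n (i k : Fin n) → upperOnes n i k ≡ ≤-indicator (toℕ i) (toℕ k)
upperOnes≡≤-indicator n i k with toℕ i ≤? toℕ k
... | yes _ = refl
... | no  _ = refl

≤-indicator-≤ : ∀ {a b} → a ≤ b → ≤-indicator a b ≡ 1ℤ
≤-indicator-≤ {a} {b} a≤b with a ≤? b
... | yes _   = refl
... | no  a≰b = ⊥-elim (a≰b a≤b)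

≤-indicator-> : ∀ {a b} → b < a → ≤-indicator a b ≡ 0ℤ
≤-indicator-> {a} {b} b<a with a ≤? b
... | yes a≤b = ⊥-elim (ℕ.<⇒≱ b<a a≤b)
... | no  _   = refl

Smat-entry : ∀ n g f (i k : Fin n) → Smat n g f i k ≡ sumTo (suc (toℕ k)) (riordan g f (toℕ i))
Smat-entry n g f i k = begin
  sumFin (λ j → row (toℕ j) * upperOnes n j k)
    ≡⟨ sumFin-cong (λ j → cong (row (toℕ j) *_) (upperOnes≡≤-indicator n j k)) ⟩
  sumFin {n} (λ j → masked (toℕ j))
    ≡⟨ sumFin≡sumTo n masked ⟩
  sumTo n masked
    ≡⟨ sumTo-truncate (suc (toℕ k)) n masked
         (λ j k<j → trans (cong (row j *_) (≤-indicator-> k<j)) (ℤ.*-zeroʳ (row j))) (Fin.toℕ<n k) ⟩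
  sumTo (suc (toℕ k)) masked
    ≡⟨ sumTo-cong (suc (toℕ k)) (λ j j≤k → trans (cong (row j *_) (≤-indicator-≤ (ℕ.≤-pred j≤k))) (ℤ.*-identityʳ (row j))) ⟩
  sumTo (suc (toℕ k)) row
    ∎
  where
  row masked : ℕ → ℤ
  row = riordan g f (toℕ i)
  masked t = row t * ≤-indicator t (toℕ k)

Smat-first-row : ∀ n g f → g 0 ≡ 1ℤ → f 0 ≡ 0ℤ → ∀ (k : Fin (suc n)) → Smat (suc n) g f fzero k ≡ 1ℤ
Smat-first-row n g f g₀≡1 f₀≡0 k = begin
  Smat (suc n) g f fzero k
    ≡⟨ Smat-entry (suc n) g f fzero k ⟩
  sumTo (suc (toℕ k)) (riordan g f 0)
    ≡⟨ sumTo-head (toℕ k) _ ⟩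
  riordan g f 0 0 + sumTo (toℕ k) (λ j → riordan g f 0 (suc j))
    ≡⟨ cong₂ _+_ corner (sumTo-0 (toℕ k) _ (λ j _ → riordan-above-diagonal g f f₀≡0 0 (suc j) (s≤s z≤n))) ⟩
  1ℤ + 0ℤ
    ∎
  where
  corner : riordan g f 0 0 ≡ 1ℤ
  corner rewrite g₀≡1 = refl

truncR-uSeries≡Smat-difference : ∀ g f → f 0 ≡ 0ℤ → ∀ m (k l : Fin m) →
  truncR m (uSeries g f) f k l ≡ Smat (suc m) g f (fsuc k) (inject₁ l) - Smat (suc m) g f (fsuc k) (fromℕ m)
truncR-uSeries≡Smat-difference g f f₀≡0 m k l
  rewrite Smat-entry (suc m) g f (fsuc k) (inject₁ l) | Smat-entry (suc m) g f (fsuc k) (fromℕ m)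
        | Fin.toℕ-inject₁ l | Fin.toℕ-fromℕ m
  = riordan-uSeries-partial-sums g f f₀≡0 m (toℕ k) (toℕ l) (Fin.toℕ<n k) (Fin.toℕ<n l)

-- Only the first row of S enters, through the entries of H S and S H in column 0 resp. row 0.
module _ {m : ℕ} (S H : Mat (suc m)) (first-row : ∀ k → S fzero k ≡ 1ℤ)
         (M : Mat m) (M≡ : ∀ k l → M k l ≡ S (fsuc k) (inject₁ l) - S (fsuc k) (fromℕ m)) where

  Psub-leftInverse : (∀ i k → (H · S) i k ≡ idMat i k) → ∀ i l → (Psub H · M) i l ≡ idMat i l
  Psub-leftInverse HS i l = begin
    sumFin (λ k → h (fsuc k) * M k l)
      ≡⟨ sumFin-cong (λ k → trans (cong (h (fsuc k) *_) (M≡ k l)) (*-distribˡ-- (h (fsuc k)) (S (fsuc k) (inject₁ l)) (S (fsuc k) (fromℕ m)))) ⟩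
    sumFin (λ k → h (fsuc k) * S (fsuc k) (inject₁ l) - h (fsuc k) * S (fsuc k) (fromℕ m))
      ≡⟨ sumFin-distrib-- (λ k → h (fsuc k) * S (fsuc k) (inject₁ l)) (λ k → h (fsuc k) * S (fsuc k) (fromℕ m)) ⟩
    tail (inject₁ l) - tail (fromℕ m)
      ≡⟨ cancel-head (h fzero) (tail (inject₁ l)) (tail (fromℕ m)) _ (row (inject₁ l) (idMat-inject₁ i l))
                                                                        (row (fromℕ m) (idMat-inject₁-fromℕ i)) ⟩
    idMat i l
      ∎
    where
    h : Fin (suc m) → ℤ
    h = H (inject₁ i)
    tail : Fin (suc m) → ℤ
    tail c = sumFin (λ k → h (fsuc k) * S (fsuc k) c)
    row : ∀ c {e} → idMat (inject₁ i) c ≡ e → h fzero * 1ℤ + tail c ≡ e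
    row c refl = trans (cong (λ z → h fzero * z + tail c) (sym (first-row c))) (HS (inject₁ i) c)
    *-distribˡ-- : ∀ x y z → x * (y - z) ≡ x * y - x * z
    *-distribˡ-- = solve-∀
    cancel-head : ∀ x y z e → x * 1ℤ + y ≡ e → x * 1ℤ + z ≡ 0ℤ → y - z ≡ e
    cancel-head x y z e eq₁ eq₂ = trans (shift x y z) (trans (cong₂ _-_ eq₁ eq₂) (ℤ.+-identityʳ e))
      where
      shift : ∀ x y z → y - z ≡ (x * 1ℤ + y) - (x * 1ℤ + z)
      shift = solve-∀

  Psub-rightInverse : (∀ i k → (S · H) i k ≡ idMat i k) → ∀ k l → (M · Psub H) k l ≡ idMat k l
  Psub-rightInverse SH k l = begin
    sumFin (λ i → M k i * h (inject₁ i))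
      ≡⟨ sumFin-cong (λ i → trans (cong (_* h (inject₁ i)) (M≡ k i)) (*-distribʳ-- (h (inject₁ i)) (s (inject₁ i)) (s (fromℕ m)))) ⟩
    sumFin (λ i → s (inject₁ i) * h (inject₁ i) - s (fromℕ m) * h (inject₁ i))
      ≡⟨ sumFin-distrib-- (λ i → s (inject₁ i) * h (inject₁ i)) (λ i → s (fromℕ m) * h (inject₁ i)) ⟩
    y - sumFin (λ i → s (fromℕ m) * h (inject₁ i))
      ≡⟨ cong (λ t → y - t) (sumFin-*ˡ (s (fromℕ m)) (λ i → h (inject₁ i))) ⟩
    y - s (fromℕ m) * z
      ≡⟨ cancel-last (s (fromℕ m)) (h (fromℕ m)) y z _ row-k row-0 ⟩
    idMat k l
      ∎
    where
    s h : Fin (suc m) → ℤ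
    s = S (fsuc k)
    h i = H i (fsuc l)
    y z : ℤ
    y = sumFin (λ i → s (inject₁ i) * h (inject₁ i))
    z = sumFin (λ i → h (inject₁ i))
    row-k : y + s (fromℕ m) * h (fromℕ m) ≡ idMat k l
    row-k = trans (sym (sumFin-last (λ j → s j * h j))) (SH (fsuc k) (fsuc l))
    row-0 : z + 1ℤ * h (fromℕ m) ≡ 0ℤ
    row-0 = begin
      z + 1ℤ * h (fromℕ m)
        ≡⟨ cong₂ _+_ (sumFin-cong (λ i → trans (sym (ℤ.*-identityˡ (h (inject₁ i)))) (cong (_* h (inject₁ i)) (sym (first-row (inject₁ i))))))
                     (cong (_* h (fromℕ m)) (sym (first-row (fromℕ m)))) ⟩
      sumFin (λ i → S fzero (inject₁ i) * h (inject₁ i)) + S fzero (fromℕ m) * h (fromℕ m)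
        ≡⟨ sym (sumFin-last (λ j → S fzero j * h j)) ⟩
      (S · H) fzero (fsuc l)
        ≡⟨ SH fzero (fsuc l) ⟩
      0ℤ
        ∎
    *-distribʳ-- : ∀ x y z → (y - z) * x ≡ y * x - z * x
    *-distribʳ-- = solve-∀
    cancel-last : ∀ c x y z e → y + c * x ≡ e → z + 1ℤ * x ≡ 0ℤ → y - c * z ≡ e
    cancel-last c x y z e eq₁ eq₂ =
      trans (shift c x y z) (trans (cong₂ (λ p q → p + (- c) * q) eq₁ eq₂)
                                   (trans (cong (e +_) (ℤ.*-zeroʳ (- c))) (ℤ.+-identityʳ e)))
      where
      shift : ∀ c x y z → y - c * z ≡ (y + c * x) + (- c) * (z + 1ℤ * x)
      shift = solve-∀

  Psub-inverse : IsInverseOf H S → IsInverseOf (Psub H) M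
  Psub-inverse (HS , SH) = Psub-leftInverse HS , Psub-rightInverse SH

mainTheorem11 : (g f : Series) → g 0 ≡ 1ℤ → f 0 ≡ 0ℤ → f 1 ≡ 1ℤ →
    (m : ℕ) → 1 ≤ m →
    (H : Mat (suc m)) → IsInverseOf H (Smat (suc m) g f) →
    IsInverseOf (Psub H) (truncR m (uSeries g f) f)
mainTheorem11 g f g₀≡1 f₀≡0 _ m _ H =
  Psub-inverse (Smat (suc m) g f) H (Smat-first-row m g f g₀≡1 f₀≡0)
               (truncR m (uSeries g f) f) (truncR-uSeries≡Smat-difference g f f₀≡0 m)
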